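{- Let $\varphi$ be a CNF formula in which every clause consists of three literals and every variable occurs in two or three clauses, let $G=G(\varphi)$ be the graph constructed below, and let $\prec$ be an elimination order for $G$. Then there is at most one clause $c$ of $\varphi$ such that $\gamma\prec x$ for every vertex $x$ of $\mathrm{Clause}(c)$.
   Context: Construction of $G(\varphi)$. For each variable $v$ occurring in $p$ clauses, of which $b$ contain the literal $v$ and $a$ contain $\neg v$ ($a+b=p$), the variable gadget $\mathrm{Var}(v)$ is an independent set of $2p+1$ vertices: $v_0$ (representative of $\neg v$), $v_1$ (representative of $v$), and transition vertices $t_1,\dots,t_{2p-1}$. For each clause $c=l_1\lor l_2\lor l_3$, the clause gadget $\mathrm{Clause}(c)$ is a clique on five vertices $c_\top, c_{l_1}, c_{l_2}, c_{l_3}, c_\bot$. Add two further vertices $\gamma$ and $\iota$. Edges: (1) for each clause $c=l_1\lor l_2\lor l_3$ and $i\in[3]$, both $c_{l_i}$ and $c_\top$ are joined to the representative of $l_i$; (2) each $c_\bot$ is joined to $\gamma$; (3) for each variable $v$: after (1), $N(v_0)=\{x_1,\dots,x_{2a}\}$ is ordered so that $x_1,\dots,x_a$ are of the form $c_\top$ and $x_{a+1},\dots,x_{2a}$ of the form $c_{l}$; $N(v_1)=\{y_1,\dots,y_{2b}\}$ is ordered so that $y_1,\dots,y_b$ are of the form $c_l$ and $y_{b+1},\dots,y_{2b}$ of the form $c_\top$; set $N(t_1)=N(v_0)\cup\{y_1\}$, $N(t_i)=N(t_{i-1})\cup\{y_i\}$ for $i\in[2,2b]$, and $N(t_i)=N(t_{i-1})\setminus\{x_{i-2b}\}$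 for $i\in[2b+1,2a+2b-1]$. The vertex $\iota$ is isolated. No other edges. Two distinct vertices $u,v$ of a graph $H$ are $1$-twins if $|(N_H(u)\setminus N_H[v])\cup(N_H(v)\setminus N_H[u])|\le 1$. An elimination order of $G$ is a total order $\prec$ on $V(G)$, listing $V(G)$ as $u_1\prec\dots\prec u_N$, such that for each $i\in[N-1]$, $u_i$ has a $1$-twin in $G-\{u_1,\dots,u_{i-1}\}$. -}

module Defs where

open import Data.Nat using (ℕ; zero; suc; _+_; _*_; _∸_; _≤?_)
open import Data.Fin using (Fin; toℕ; _≟_)
open import Data.Fin.Properties using (any?)
open import Data.Bool using (Bool; true; false; if_then_else_)
open import Data.Product using (_×_; _,_; proj₁; proj₂; ∃; ∃₂)
open import Data.Sum using (_⊎_)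
open import Data.Empty using (⊥)
open import Data.List using (List; []; _∷_; _++_; map; length; filter; allFin)
open import Data.List.Membership.Propositional using (_∈_)
open import Data.List.Relation.Unary.Unique.Propositional using (Unique)
open import Relation.Nullary using (¬_; does)
open import Relation.Binary.PropositionalEquality using (_≡_; _≢_)
open import Function.Bundles using (_⇔_)

-- 3-CNF formulas.  Variables are Fin nv, clauses are indexed by Fin nc,
-- each clause has exactly three literals (indexed by Fin 3).
-- A literal is (v , true) = v  or  (v , false) = ¬ v.

record CNF : Set where
  field
    nv     : ℕ
    nc     : ℕ
    clause : Fin nc → Fin 3 → Fin nv × Bool
open CNF public

ThreeDistinct : CNF → Set
ThreeDistinct φ = ∀ c j k → j ≢ k → proj₁ (clause φ c j) ≢ proj₁ (clause φ c k)

occ : (φ : CNF) → Fin (nv φ) → ℕ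
occ φ v = length (filter (λ c → any? (λ j → proj₁ (clause φ c j) ≟ v)) (allFin (nc φ)))

OccursTwoOrThree : CNF → Set
OccursTwoOrThree φ = ∀ v → occ φ v ≡ 2 ⊎ occ φ v ≡ 3

-- Clause-gadget vertices: c⊤ c, cl c j (= c_{l_j}), c⊥ c.

data CV (nc : ℕ) : Set where
  c⊤ : Fin nc → CV nc
  cl : Fin nc → Fin 3 → CV nc
  c⊥ : Fin nc → CV nc

clauseOf : ∀ {nc} → CV nc → Fin nc
clauseOf (c⊤ c)   = c
clauseOf (cl c _) = c
clauseOf (c⊥ c)   = c

data RepAdj (φ : CNF) (v : Fin (nv φ)) (s : Bool) : CV (nc φ) → Set where
  toLit : ∀ c j → clause φ c j ≡ (v , s) → RepAdj φ v s (cl c j)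
  toTop : ∀ c j → clause φ c j ≡ (v , s) → RepAdj φ v s (c⊤ c)

mkX : ∀ {nc} → List (Fin nc) → List (Fin nc × Fin 3) → List (CV nc)
mkX tops lits = map c⊤ tops ++ map (λ p → cl (proj₁ p) (proj₂ p)) lits

mkY : ∀ {nc} → List (Fin nc × Fin 3) → List (Fin nc) → List (CV nc)
mkY lits tops = map (λ p → cl (proj₁ p) (proj₂ p)) lits ++ map c⊤ tops

-- The (arbitrary) orderings used in step (3):
--   N(v_0) = x_1 … x_{2a} = mkX xTop xLit   (first the c_⊤'s, then the c_l's)
--   N(v_1) = y_1 … y_{2b} = mkY yLit yTop   (first the c_l's, then the c_⊤'s)
-- each a duplicate-free enumeration of the neighbourhood after step (1).
record VarOrder (φ : CNF) (v : Fin (nv φ)) : Set where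
  field
    xTop : List (Fin (nc φ))
    xLit : List (Fin (nc φ) × Fin 3)
    yLit : List (Fin (nc φ) × Fin 3)
    yTop : List (Fin (nc φ))
    x-unique   : Unique (mkX xTop xLit)
    x-complete : ∀ x → (x ∈ mkX xTop xLit) ⇔ RepAdj φ v false x
    y-unique   : Unique (mkY yLit yTop)
    y-complete : ∀ x → (x ∈ mkY yLit yTop) ⇔ RepAdj φ v true x

Orders : CNF → Set
Orders φ = (v : Fin (nv φ)) → VarOrder φ v

-- Nth xs i x : x is the element at (0-based) position i of xs
Nth : {A : Set} → List A → ℕ → A → Set
Nth []       _       _ = ⊥
Nth (y ∷ ys) zero    x = x ≡ y
Nth (y ∷ ys) (suc i) x = Nth ys i x

module Construction (φ : CNF) (O : Orders φ) where

  xs : Fin (nv φ) → List (CV (nc φ))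
  xs v = mkX (VarOrder.xTop (O v)) (VarOrder.xLit (O v))

  ys : Fin (nv φ) → List (CV (nc φ))
  ys v = mkY (VarOrder.yLit (O v)) (VarOrder.yTop (O v))

  -- number of transition vertices: 2a + 2b - 1 = 2p - 1
  tcount : Fin (nv φ) → ℕ
  tcount v = length (xs v) + length (ys v) ∸ 1

  data Vertex : Set where
    cvtx : CV (nc φ) → Vertex
    rep  : Fin (nv φ) → Bool → Vertex        -- rep v false = v_0, rep v true = v_1
    tr   : (v : Fin (nv φ)) → Fin (tcount v) → Vertex   -- tr v i = t_{i+1}
    γ    : Vertex
    ι    : Vertex

  -- NT v i x : x ∈ N(t_i)  (with N(t_0) := N(v_0)), following step (3):
  --   N(t_i) = N(t_{i-1}) ∪ {y_i}          for i ≤ 2b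
  --   N(t_i) = N(t_{i-1}) ∖ {x_{i-2b}}     for i > 2b
  NT : Fin (nv φ) → ℕ → CV (nc φ) → Set
  NT v zero    x = RepAdj φ v false x
  NT v (suc i) x =
    if does (suc i ≤? length (ys v))
    then (NT v i x ⊎ Nth (ys v) i x)
    else (NT v i x × ¬ Nth (xs v) (i ∸ length (ys v)) x)

  data E : Vertex → Vertex → Set where
    eClique : ∀ {x y} → clauseOf x ≡ clauseOf y → x ≢ y → E (cvtx x) (cvtx y)
    eRep    : ∀ {v s x} → RepAdj φ v s x → E (rep v s) (cvtx x)
    eBot    : ∀ c → E (cvtx (c⊥ c)) γ
    eTr     : ∀ {v i x} → NT v (suc (toℕ i)) x → E (tr v i) (cvtx x)

  Adj : Vertex → Vertex → Set
  Adj u w = E u w ⊎ E w u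

-- 1-twins and elimination orders, for a graph given by an adjacency
-- relation on a type V.  A vertex set / order is a duplicate-free list.

module _ {V : Set} (Adj : V → V → Set) where

  SymDiff : List V → V → V → V → Set
  SymDiff S u w x =
    x ∈ S × ((Adj u x × ¬ (Adj w x ⊎ x ≡ w)) ⊎ (Adj w x × ¬ (Adj u x ⊎ x ≡ u)))

  OneTwins : List V → V → V → Set
  OneTwins S u w =
    u ∈ S × w ∈ S × u ≢ w ×
    (∀ x y → SymDiff S u w x → SymDiff S u w y → x ≡ y)

  EliminationOrder : List V → Set
  EliminationOrder ord =
    Unique ord × (∀ x → x ∈ ord) ×
    (∀ pre u rest → ord ≡ pre ++ u ∷ rest → rest ≢ [] →
       ∃ λ w → OneTwins (u ∷ rest) u w)

Precedes : {V : Set} → List V → V → V → Set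
Precedes ord a b = ∃₂ λ pre rest → ord ≡ pre ++ a ∷ rest × b ∈ rest

-- When γ is eliminated it must have a 1-twin w in the remaining graph.  If two
-- distinct clauses c, c' still survive entirely, then c⊥ and c'⊥ are neighbours
-- of γ, and w cannot lie in the closed neighbourhood of either: that would make
-- w a vertex of, say, Clause(c), and then a sibling of w in Clause(c) (adjacent to
-- w but not to γ) and c'⊥ (adjacent to γ but not to w) are two distinct vertices
-- of the symmetric difference.  Hence c⊥ and c'⊥ both lie in the symmetric
-- difference, so they coincide and c = c'.  Only the neighbourhoods of γ and of
-- the c⊥ vertices enter.
module Submission where

open import Defs
open import Data.Bool using (true; false)
open import Data.Empty using (⊥-elim)
open import Data.Fin using (zero; _≟_)
open import Data.List using (List; []; _∷_; _++_; length)
open import Data.List.Membership.Propositional using (_∈_)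
open import Data.List.Membership.Propositional.Properties using (∈-insert)
open import Data.List.Properties using (∷-injectiveʳ)
open import Data.List.Relation.Unary.All as All using ()
open import Data.List.Relation.Unary.AllPairs using (_∷_)
open import Data.List.Relation.Unary.Any using (here; there)
open import Data.List.Relation.Unary.Unique.Propositional using (Unique)
open import Data.Nat using (zero; suc; _≤?_)
open import Data.Product using (_×_; _,_; proj₁; proj₂; ∃)
open import Data.Sum using (_⊎_; inj₁; inj₂)
open import Function.Bundles using (Equivalence)
open import Relation.Binary.PropositionalEquality using (_≡_; refl; sym; trans; subst; _≢_)
open import Relation.Nullary using (¬_; yes; no; does)

module _ {A : Set} where

  Nth⇒∈ : ∀ (xs : List A) i {x} → Nth xs i x → x ∈ xs
  Nth⇒∈ (y ∷ ys) zero    x≡y = here x≡y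
  Nth⇒∈ (y ∷ ys) (suc i) nth = there (Nth⇒∈ ys i nth)

  ∈⇒≢[] : ∀ {xs : List A} {x} → x ∈ xs → xs ≢ []
  ∈⇒≢[] (here _)  ()
  ∈⇒≢[] (there _) ()

  unique-suffix : ∀ (pre pre′ : List A) {a rest rest′} → Unique (pre ++ a ∷ rest) →
                  pre ++ a ∷ rest ≡ pre′ ++ a ∷ rest′ → rest ≡ rest′
  unique-suffix []        []         _         refl = refl
  unique-suffix []        (b ∷ pre′) (a∉ ∷ _) refl = ⊥-elim (All.lookup a∉ (∈-insert pre′) refl)
  unique-suffix (b ∷ pre) []         (a∉ ∷ _) refl = ⊥-elim (All.lookup a∉ (∈-insert pre) refl)
  unique-suffix (b ∷ pre) (_ ∷ pre′) (_ ∷ u)  eq   = unique-suffix pre pre′ u (∷-injectiveʳ eq)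

  precedes⇒∈-suffix : ∀ pre {a b rest} → Unique (pre ++ a ∷ rest) →
                      Precedes (pre ++ a ∷ rest) a b → b ∈ rest
  precedes⇒∈-suffix pre u (pre′ , rest′ , eq , b∈rest′) =
    subst (_ ∈_) (sym (unique-suffix pre pre′ u eq)) b∈rest′

sibling : ∀ {n} → CV n → CV n
sibling (c⊤ c)   = cl c zero
sibling (cl c _) = c⊤ c
sibling (c⊥ c)   = c⊤ c

sibling-clauseOf : ∀ {n} (x : CV n) → clauseOf (sibling x) ≡ clauseOf x
sibling-clauseOf (c⊤ _)   = refl
sibling-clauseOf (cl _ _) = refl
sibling-clauseOf (c⊥ _)   = refl

x≢sibling : ∀ {n} (x : CV n) → x ≢ sibling x
x≢sibling (c⊤ _)   ()
x≢sibling (cl _ _) ()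
x≢sibling (c⊥ _)   ()

sibling≢c⊥ : ∀ {n} (x : CV n) d → sibling x ≢ c⊥ d
sibling≢c⊥ (c⊤ _)   _ ()
sibling≢c⊥ (cl _ _) _ ()
sibling≢c⊥ (c⊥ _)   _ ()

module _ (φ : CNF) (O : Orders φ) where
  open Construction φ O

  NT⊆RepAdj : ∀ v n {x} → NT v n x → RepAdj φ v false x ⊎ RepAdj φ v true x
  NT⊆RepAdj v zero    x∈ = inj₁ x∈
  NT⊆RepAdj v (suc i) {x} x∈ with does (suc i ≤? length (ys v))
  ... | true  with x∈
  ...   | inj₁ x∈N = NT⊆RepAdj v i x∈N
  ...   | inj₂ nth = inj₂ (Equivalence.to (VarOrder.y-complete (O v) x) (Nth⇒∈ (ys v) i nth))
  NT⊆RepAdj v (suc i) x∈ | false = NT⊆RepAdj v i (proj₁ x∈)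

  ¬RepAdj-c⊥ : ∀ {v s d} → ¬ RepAdj φ v s (c⊥ d)
  ¬RepAdj-c⊥ ()

  ¬NT-c⊥ : ∀ v n {d} → ¬ NT v n (c⊥ d)
  ¬NT-c⊥ v n x∈ with NT⊆RepAdj v n x∈
  ... | inj₁ r = ¬RepAdj-c⊥ r
  ... | inj₂ r = ¬RepAdj-c⊥ r

  Adj-c⊥ : ∀ {w d} → Adj w (cvtx (c⊥ d)) → (∃ λ x → w ≡ cvtx x × clauseOf x ≡ d) ⊎ w ≡ γ
  Adj-c⊥ (inj₁ (eClique eq _))  = inj₁ (_ , refl , eq)
  Adj-c⊥ (inj₁ (eRep r))        = ⊥-elim (¬RepAdj-c⊥ r)
  Adj-c⊥ (inj₁ (eTr {v} x∈))    = ⊥-elim (¬NT-c⊥ v _ x∈)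
  Adj-c⊥ (inj₂ (eClique eq _))  = inj₁ (_ , refl , sym eq)
  Adj-c⊥ (inj₂ (eBot _))        = inj₂ refl

  Adj-γ : ∀ {x} → Adj γ (cvtx x) → ∃ λ d → x ≡ c⊥ d
  Adj-γ (inj₂ (eBot d)) = d , refl

  Adj-cvtx : ∀ {x y} → Adj (cvtx x) (cvtx y) → clauseOf x ≡ clauseOf y
  Adj-cvtx (inj₁ (eClique eq _)) = eq
  Adj-cvtx (inj₂ (eClique eq _)) = sym eq

  cvtx-injective : ∀ {x y} → cvtx x ≡ cvtx y → x ≡ y
  cvtx-injective refl = refl

  ¬γ-twin-in-clause : ∀ S {x d d′} → clauseOf x ≡ d → d ≢ d′ →
                      (∀ y → clauseOf y ≡ d → cvtx y ∈ S) → cvtx (c⊥ d′) ∈ S →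
                      ¬ OneTwins Adj S γ (cvtx x)
  ¬γ-twin-in-clause S {x} {d} {d′} x∈d d≢d′ clause⊆S c⊥′∈S (_ , _ , _ , unique) =
    sibling≢c⊥ x d′ (cvtx-injective (unique _ _ sibling∈ c⊥′∈))
    where
    x≢d′ : clauseOf x ≢ d′
    x≢d′ eq = d≢d′ (trans (sym x∈d) eq)

    sibling∈ : SymDiff Adj S γ (cvtx x) (cvtx (sibling x))
    sibling∈ = clause⊆S (sibling x) (trans (sibling-clauseOf x) x∈d)
             , inj₂ ( inj₁ (eClique (sym (sibling-clauseOf x)) (x≢sibling x))
                    , λ { (inj₁ a) → sibling≢c⊥ x _ (proj₂ (Adj-γ a)) ; (inj₂ ()) })

    c⊥′∈ : SymDiff Adj S γ (cvtx x) (cvtx (c⊥ d′))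
    c⊥′∈ = c⊥′∈S
         , inj₁ ( inj₂ (eBot d′)
                , λ { (inj₁ a) → x≢d′ (Adj-cvtx a) ; (inj₂ refl) → x≢d′ refl })

  γ-twin-∉N[c⊥] : ∀ S {w d d′} → d ≢ d′ → OneTwins Adj S γ w →
                  (∀ x → clauseOf x ≡ d → cvtx x ∈ S) → cvtx (c⊥ d′) ∈ S →
                  ¬ (Adj w (cvtx (c⊥ d)) ⊎ cvtx (c⊥ d) ≡ w)
  γ-twin-∉N[c⊥] S d≢d′ twin clause⊆S c⊥′∈S (inj₂ refl) =
    ¬γ-twin-in-clause S refl d≢d′ clause⊆S c⊥′∈S twin
  γ-twin-∉N[c⊥] S d≢d′ twin@(_ , _ , γ≢w , _) clause⊆S c⊥′∈S (inj₁ adj) with Adj-c⊥ adj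
  ... | inj₂ refl             = γ≢w refl
  ... | inj₁ (x , refl , x∈d) = ¬γ-twin-in-clause S x∈d d≢d′ clause⊆S c⊥′∈S twin

  γ-has-no-twin : ∀ S {w c c′} → c ≢ c′ →
                  (∀ x → clauseOf x ≡ c ⊎ clauseOf x ≡ c′ → cvtx x ∈ S) →
                  ¬ OneTwins Adj S γ w
  γ-has-no-twin S {c = c} {c′} c≢c′ clauses⊆S twin@(_ , _ , _ , unique) =
    c≢c′ (c⊥-injective (unique _ _ (c⊥-private c≢c′ (λ _ → inj₁) (λ _ → inj₂))
                                   (c⊥-private (λ e → c≢c′ (sym e)) (λ _ → inj₂) (λ _ → inj₁))))
    where
    c⊥-injective : ∀ {d d′} → cvtx (c⊥ d) ≡ cvtx (c⊥ d′) → d ≡ d′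
    c⊥-injective refl = refl

    c⊥-private : ∀ {d d′} → d ≢ d′ →
                 (∀ x → clauseOf x ≡ d → clauseOf x ≡ c ⊎ clauseOf x ≡ c′) →
                 (∀ x → clauseOf x ≡ d′ → clauseOf x ≡ c ⊎ clauseOf x ≡ c′) →
                 SymDiff Adj S γ _ (cvtx (c⊥ d))
    c⊥-private d≢d′ d∈ d′∈ =
      clauses⊆S _ (d∈ (c⊥ _) refl)
      , inj₁ ( inj₂ (eBot _)
             , γ-twin-∉N[c⊥] S d≢d′ twin (λ x e → clauses⊆S x (d∈ x e))
                             (clauses⊆S _ (d′∈ (c⊥ _) refl)))

lemma6p2 : (φ : CNF) → ThreeDistinct φ → OccursTwoOrThree φ →
    (O : Orders φ) → (ord : List (Construction.Vertex φ O)) →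
    EliminationOrder (Construction.Adj φ O) ord →
    ∀ c c' →
    (∀ x → clauseOf x ≡ c → Precedes ord (Construction.γ {φ} {O}) (Construction.cvtx x)) →
    (∀ x → clauseOf x ≡ c' → Precedes ord (Construction.γ {φ} {O}) (Construction.cvtx x)) →
    c ≡ c'
lemma6p2 φ _ _ O ord (unique , _ , elimination) c c′ γ≺c γ≺c′ with c ≟ c′
... | yes c≡c′ = c≡c′
... | no c≢c′ with γ≺c (c⊥ c) refl
...   | pre , rest , refl , c⊥∈rest =
  ⊥-elim (γ-has-no-twin φ O (γ ∷ rest) c≢c′ clauses⊆S (proj₂ γ-twin))
  where
  open Construction φ O

  γ-twin : ∃ λ w → OneTwins Adj (γ ∷ rest) γ w
  γ-twin = elimination pre γ rest refl (∈⇒≢[] c⊥∈rest)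

  clauses⊆S : ∀ x → clauseOf x ≡ c ⊎ clauseOf x ≡ c′ → cvtx x ∈ γ ∷ rest
  clauses⊆S x (inj₁ x∈c)  = there (precedes⇒∈-suffix pre unique (γ≺c x x∈c))
  clauses⊆S x (inj₂ x∈c′) = there (precedes⇒∈-suffix pre unique (γ≺c′ x x∈c′))
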